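{- Let $\mathfrak B_n$ be the group of signed permutations, i.e. permutations $w$ of $\{ -n,\dots,-1,1,\dots,n\}$ with $w(-i)=-w(i)$, viewed as a Coxeter group with generators $S=\{\tau_0,\dots,\tau_{n-1}\}$, where $\tau_0$ is the transposition $(-1,1)$ and, for $i\ge1$, $\tau_i=(i,i+1)(-i,-i-1)$. For $u\in\mathfrak B_n$, with the convention $u(0)=0$, $$C(u)=\{\tau_i: 0\le i\le n-1,\ |u(j)|<u(k)\ \text{for all } 0\le j\le i<k\le n\}.$$
   Context: For $w$ in a Coxeter system $(W,S)$, $C(w)$ is the set of simple reflections in $S$ not occurring in any reduced expression of $w$. -}

module Defs where

open import Data.Nat using (ℕ; zero; suc)
open import Data.Integer using (ℤ; +_; -_; ∣_∣; _<_)
open import Data.Fin using (Fin; toℕ)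
open import Data.Vec using (Vec; []; _∷_; tabulate; lookup)
open import Data.List using (List; foldl; length)
open import Data.List.Membership.Propositional using (_∈_)
open import Data.Product using (Σ; ∃; _×_)
open import Relation.Binary.PropositionalEquality using (_≡_)
open import Relation.Nullary using (¬_)
import Data.Nat as N

-- An element u of the hyperoctahedral group B_n is represented by its window
-- [u(1), ..., u(n)] (a vector of integers); u(-i) = -u(i) and u(0) = 0.

IsSignedPerm : {n : ℕ} → Vec ℤ n → Set
IsSignedPerm {n} u =
  (∀ (j : Fin n) → 1 N.≤ ∣ lookup u j ∣ × ∣ lookup u j ∣ N.≤ n)
  × (∀ (j k : Fin n) → ∣ lookup u j ∣ ≡ ∣ lookup u k ∣ → j ≡ k)

idW : (n : ℕ) → Vec ℤ n
idW n = tabulate (λ j → + suc (toℕ j))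

negHead : {n : ℕ} → Vec ℤ n → Vec ℤ n
negHead [] = []
negHead (x ∷ xs) = (- x) ∷ xs

swapAt : {n : ℕ} → ℕ → Vec ℤ n → Vec ℤ n
swapAt zero (x ∷ y ∷ xs) = y ∷ x ∷ xs
swapAt zero xs = xs
swapAt (suc k) [] = []
swapAt (suc k) (x ∷ xs) = x ∷ swapAt k xs

-- right multiplication u ↦ u τ_i, where τ₀ = (-1,1), τ_i = (i,i+1)(-i,-i-1)
-- composition convention (u v)(j) = u(v(j)).
mulGen : {n : ℕ} → Vec ℤ n → Fin n → Vec ℤ n
mulGen u i with toℕ i
... | zero = negHead u
... | suc j = swapAt j u   -- swaps 1-based positions i, i+1

prod : {n : ℕ} → List (Fin n) → Vec ℤ n
prod {n} w = foldl mulGen (idW n) w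

IsReduced : {n : ℕ} → List (Fin n) → Vec ℤ n → Set
IsReduced {n} w u =
  prod w ≡ u × (∀ (w' : List (Fin n)) → prod w' ≡ u → length w N.≤ length w')

InC : {n : ℕ} → Fin n → Vec ℤ n → Set
InC {n} i u = ¬ (Σ (List (Fin n)) λ w → IsReduced w u × i ∈ w)

-- window entry u(j) for j ≥ 1 (0-based index into the vector)
at : {n : ℕ} → Vec ℤ n → ℕ → ℤ
at [] _ = + 0
at (x ∷ xs) zero = x
at (x ∷ xs) (suc k) = at xs k

val : {n : ℕ} → Vec ℤ n → ℕ → ℤ
val u zero = + 0
val u (suc j) = at u j

Cond : {n : ℕ} → Fin n → Vec ℤ n → Set
Cond {n} i u = ∀ (j k : ℕ) → j N.≤ toℕ i → toℕ i N.< k → k N.≤ n →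
  + ∣ val u j ∣ < val u k

-- ℓ(u), the number of type-B inversions of the window of u, changes by at most one under right
-- multiplication by a generator and drops by one at every descent; a signed permutation without
-- descents is the identity, so greedy descent yields a word of length ℓ(u), and ℓ is the Coxeter
-- length. For m ≠ i the generator τ_m preserves the condition, which holds at the identity, so it
-- holds whenever some reduced word avoids τ_i. Conversely, if the condition holds and a τ_i b is a
-- reduced word with no τ_i in b, the condition also holds for u b⁻¹ = prod(a) τ_i; this makes τ_i a
-- descent of prod(a), so ℓ(u) < |a τ_i b|, contradicting reducedness.
module Submission where

open import Defs
open import Data.Nat using (ℕ; zero; suc; z≤n; s≤s; _+_; _≤_; _<_; _≤?_)
open import Data.Nat.Properties
open import Algebra.Properties.CommutativeSemigroup +-commutativeSemigroup using (x∙yz≈y∙xz)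
open import Data.Nat.Tactic.RingSolver using (solve-∀)
open import Data.Integer as ℤ using (ℤ; +_; -[1+_]; -_; ∣_∣; 0ℤ)
import Data.Integer.Properties as ℤₚ
open import Data.Fin as Fin using (Fin; toℕ; fromℕ<)
import Data.Fin.Properties as Finₚ
open import Data.Vec using (Vec; []; _∷_; tabulate; lookup)
import Data.Vec.Properties as Vecₚ
open import Data.List using (List; []; _∷_; _++_; length; foldl; [_])
import Data.List.Properties as Listₚ
open import Data.List.Membership.Propositional using (_∈_; _∉_)
open import Data.List.Relation.Unary.Any using (here; there; any?)
open import Data.Product using (Σ; ∃₂; _×_; _,_; proj₁; proj₂)
open import Data.Empty using (⊥-elim)
open import Function.Base using (_∘_)
open import Function.Bundles using (_⇔_; mk⇔)
open import Relation.Nullary using (¬_; yes; no)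
open import Relation.Binary.PropositionalEquality hiding ([_])

mulGenℕ : ∀ {n} → Vec ℤ n → ℕ → Vec ℤ n
mulGenℕ v zero    = negHead v
mulGenℕ v (suc p) = swapAt p v

mulGen≡mulGenℕ : ∀ {n} (v : Vec ℤ n) (m : Fin n) → mulGen v m ≡ mulGenℕ v (toℕ m)
mulGen≡mulGenℕ v m with toℕ m
... | zero  = refl
... | suc p = refl

negHead-involutive : ∀ {n} (v : Vec ℤ n) → negHead (negHead v) ≡ v
negHead-involutive []       = refl
negHead-involutive (x ∷ xs) = cong (_∷ xs) (ℤₚ.neg-involutive x)

swapAt-involutive : ∀ {n} p (v : Vec ℤ n) → swapAt p (swapAt p v) ≡ v
swapAt-involutive zero    []          = refl
swapAt-involutive zero    (x ∷ [])    = refl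
swapAt-involutive zero    (x ∷ y ∷ r) = refl
swapAt-involutive (suc p) []          = refl
swapAt-involutive (suc p) (x ∷ xs)    = cong (x ∷_) (swapAt-involutive p xs)

mulGenℕ-involutive : ∀ {n} (v : Vec ℤ n) k → mulGenℕ (mulGenℕ v k) k ≡ v
mulGenℕ-involutive v zero    = negHead-involutive v
mulGenℕ-involutive v (suc p) = swapAt-involutive p v

mulGen-involutive : ∀ {n} (v : Vec ℤ n) m → mulGen (mulGen v m) m ≡ v
mulGen-involutive v m = begin
  mulGen (mulGen v m) m                ≡⟨ mulGen≡mulGenℕ (mulGen v m) m ⟩
  mulGenℕ (mulGen v m) (toℕ m)         ≡⟨ cong (λ w → mulGenℕ w (toℕ m)) (mulGen≡mulGenℕ v m) ⟩
  mulGenℕ (mulGenℕ v (toℕ m)) (toℕ m)  ≡⟨ mulGenℕ-involutive v (toℕ m) ⟩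
  v                                    ∎
  where open ≡-Reasoning

prod-++-∷ : ∀ {n} (a : List (Fin n)) m b → prod (a ++ m ∷ b) ≡ foldl mulGen (mulGen (prod a) m) b
prod-++-∷ {n} a m b = Listₚ.foldl-++ mulGen (idW n) a (m ∷ b)

at-negHead-zero : ∀ {n} (v : Vec ℤ n) → at (negHead v) 0 ≡ - at v 0
at-negHead-zero []       = refl
at-negHead-zero (x ∷ xs) = refl

at-negHead-suc : ∀ {n} (v : Vec ℤ n) j → at (negHead v) (suc j) ≡ at v (suc j)
at-negHead-suc []       j = refl
at-negHead-suc (x ∷ xs) j = refl

∣at-negHead∣ : ∀ {n} (v : Vec ℤ n) j → ∣ at (negHead v) j ∣ ≡ ∣ at v j ∣
∣at-negHead∣ v zero    = trans (cong ∣_∣ (at-negHead-zero v)) (ℤₚ.∣-i∣≡∣i∣ (at v 0))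
∣at-negHead∣ v (suc j) = cong ∣_∣ (at-negHead-suc v j)

swapIndex : ℕ → ℕ → ℕ
swapIndex zero    zero          = 1
swapIndex zero    (suc zero)    = 0
swapIndex zero    (suc (suc j)) = suc (suc j)
swapIndex (suc a) zero          = zero
swapIndex (suc a) (suc j)       = suc (swapIndex a j)

swapIndex-self : ∀ a → swapIndex a a ≡ suc a
swapIndex-self zero    = refl
swapIndex-self (suc a) = cong suc (swapIndex-self a)

swapIndex-suc : ∀ a → swapIndex a (suc a) ≡ a
swapIndex-suc zero    = refl
swapIndex-suc (suc a) = cong suc (swapIndex-suc a)

swapIndex-involutive : ∀ a j → swapIndex a (swapIndex a j) ≡ j
swapIndex-involutive zero    zero          = refl
swapIndex-involutive zero    (suc zero)    = refl
swapIndex-involutive zero    (suc (suc j)) = refl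
swapIndex-involutive (suc a) zero          = refl
swapIndex-involutive (suc a) (suc j)       = cong suc (swapIndex-involutive a j)

swapIndex-≤ : ∀ a {i j} → a ≢ i → j ≤ i → swapIndex a j ≤ i
swapIndex-≤ zero    {j = zero}        0≢i _         = n≢0⇒n>0 (0≢i ∘ sym)
swapIndex-≤ zero    {j = suc zero}    _   _         = z≤n
swapIndex-≤ zero    {j = suc (suc j)} _   j≤i       = j≤i
swapIndex-≤ (suc a) {j = zero}        _   _         = z≤n
swapIndex-≤ (suc a) {suc i} {suc j}   a≢i (s≤s j≤i) = s≤s (swapIndex-≤ a (a≢i ∘ cong suc) j≤i)

swapIndex-> : ∀ a {i k} → a ≢ i → i < k → i < swapIndex a k
swapIndex-> a {i} {k} a≢i i<k = ≰⇒> λ σk≤i →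
  <⇒≱ i<k (subst (_≤ i) (swapIndex-involutive a k) (swapIndex-≤ a a≢i σk≤i))

swapIndex-< : ∀ {n} a {j} → suc a < n → j < n → swapIndex a j < n
swapIndex-< a (s≤s a<n′) (s≤s j≤n′) = s≤s (swapIndex-≤ a (<⇒≢ a<n′) j≤n′)

at-swapAt : ∀ {n} p (v : Vec ℤ n) j → suc p < n → at (swapAt p v) j ≡ at v (swapIndex p j)
at-swapAt zero    (x ∷ [])    j             (s≤s ())
at-swapAt zero    (x ∷ y ∷ r) zero          _ = refl
at-swapAt zero    (x ∷ y ∷ r) (suc zero)    _ = refl
at-swapAt zero    (x ∷ y ∷ r) (suc (suc j)) _ = refl
at-swapAt (suc p) (x ∷ xs)    zero          _ = refl
at-swapAt (suc p) (x ∷ xs)    (suc j) (s≤s p<n) = at-swapAt p xs j p<n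

lookup≡at : ∀ {n} (v : Vec ℤ n) (j : Fin n) → lookup v j ≡ at v (toℕ j)
lookup≡at (x ∷ xs) Fin.zero    = refl
lookup≡at (x ∷ xs) (Fin.suc j) = lookup≡at xs j

at≡lookup : ∀ {n} (v : Vec ℤ n) j (j<n : j < n) → at v j ≡ lookup v (fromℕ< j<n)
at≡lookup v j j<n = trans (cong (at v) (sym (Finₚ.toℕ-fromℕ< j<n))) (sym (lookup≡at v _))

at-ext : ∀ {n} (v w : Vec ℤ n) → (∀ j → j < n → at v j ≡ at w j) → v ≡ w
at-ext []       []       _  = refl
at-ext (x ∷ xs) (y ∷ ys) eq = cong₂ _∷_ (eq 0 (s≤s z≤n)) (at-ext xs ys (λ j j<n → eq (suc j) (s≤s j<n)))

at-idW : ∀ n j → j < n → at (idW n) j ≡ + suc j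
at-idW n j j<n = begin
  at (idW n) j                           ≡⟨ at≡lookup (idW n) j j<n ⟩
  lookup (idW n) (fromℕ< j<n)            ≡⟨ Vecₚ.lookup∘tabulate _ (fromℕ< j<n) ⟩
  + suc (toℕ (fromℕ< j<n))               ≡⟨ cong (+_ ∘ suc) (Finₚ.toℕ-fromℕ< j<n) ⟩
  + suc j                                ∎
  where open ≡-Reasoning

record IsSignedPermℕ {n} (v : Vec ℤ n) : Set where
  field
    ∣at∣-bounds    : ∀ j → j < n → 1 ≤ ∣ at v j ∣ × ∣ at v j ∣ ≤ n
    ∣at∣-injective : ∀ {j k} → j < n → k < n → ∣ at v j ∣ ≡ ∣ at v k ∣ → j ≡ k

open IsSignedPermℕ

IsSignedPerm⇒IsSignedPermℕ : ∀ {n} (u : Vec ℤ n) → IsSignedPerm u → IsSignedPermℕ u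
IsSignedPerm⇒IsSignedPermℕ {n} u (bounds , injective) = record
  { ∣at∣-bounds    = λ j j<n → subst (λ x → 1 ≤ ∣ x ∣ × ∣ x ∣ ≤ n)
                                     (sym (at≡lookup u j j<n)) (bounds (fromℕ< j<n))
  ; ∣at∣-injective = λ {j} {k} j<n k<n eq → begin
      j                    ≡⟨ Finₚ.toℕ-fromℕ< j<n ⟨
      toℕ (fromℕ< j<n)     ≡⟨ cong toℕ (injective _ _ (begin
        ∣ lookup u (fromℕ< j<n) ∣ ≡⟨ cong ∣_∣ (at≡lookup u j j<n) ⟨
        ∣ at u j ∣                ≡⟨ eq ⟩
        ∣ at u k ∣                ≡⟨ cong ∣_∣ (at≡lookup u k k<n) ⟩
        ∣ lookup u (fromℕ< k<n) ∣ ∎)) ⟩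
      toℕ (fromℕ< k<n)     ≡⟨ Finₚ.toℕ-fromℕ< k<n ⟩
      k                    ∎
  }
  where open ≡-Reasoning

IsSignedPermℕ-reindex : ∀ {n} {v w : Vec ℤ n} (σ : ℕ → ℕ) →
  (∀ j → j < n → σ j < n) → (∀ j → σ (σ j) ≡ j) →
  (∀ j → j < n → ∣ at w j ∣ ≡ ∣ at v (σ j) ∣) →
  IsSignedPermℕ v → IsSignedPermℕ w
IsSignedPermℕ-reindex {n} {v} {w} σ σ-< σ-involutive eq sp = record
  { ∣at∣-bounds    = λ j j<n → subst (λ x → 1 ≤ x × x ≤ n) (sym (eq j j<n))
                                     (∣at∣-bounds sp (σ j) (σ-< j j<n))
  ; ∣at∣-injective = λ {j} {k} j<n k<n e → begin
      j         ≡⟨ σ-involutive j ⟨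
      σ (σ j)   ≡⟨ cong σ (∣at∣-injective sp (σ-< j j<n) (σ-< k k<n)
                     (trans (sym (eq j j<n)) (trans e (eq k k<n)))) ⟩
      σ (σ k)   ≡⟨ σ-involutive k ⟩
      k         ∎
  }
  where open ≡-Reasoning

IsSignedPermℕ-mulGen : ∀ {n} (v : Vec ℤ n) m → IsSignedPermℕ v → IsSignedPermℕ (mulGen v m)
IsSignedPermℕ-mulGen v m = subst IsSignedPermℕ (sym (mulGen≡mulGenℕ v m)) ∘ reindex (toℕ m) (Finₚ.toℕ<n m)
  where
  reindex : ∀ k → k < _ → IsSignedPermℕ v → IsSignedPermℕ (mulGenℕ v k)
  reindex zero    _   = IsSignedPermℕ-reindex (λ j → j) (λ _ j<n → j<n) (λ _ → refl) (λ j _ → ∣at-negHead∣ v j)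
  reindex (suc p) p<n = IsSignedPermℕ-reindex (swapIndex p) (λ _ → swapIndex-< p p<n)
                          (swapIndex-involutive p) (λ j _ → cong ∣_∣ (at-swapAt p v j p<n))

-- Type-B length

χ⁺ : ℤ → ℕ
χ⁺ (+ suc _) = 1
χ⁺ _         = 0

inversions₂ : ℤ → ℤ → ℕ
inversions₂ x y = χ⁺ (x ℤ.- y) + χ⁺ (- (x ℤ.+ y))

inversionsWith : ∀ {n} → ℤ → Vec ℤ n → ℕ
inversionsWith x []       = 0
inversionsWith x (y ∷ ys) = inversions₂ x y + inversionsWith x ys

-- The type-B inversion number: the entries u(j) < 0, plus the pairs j < k with u(j) > u(k),
-- plus the pairs j < k with u(j) + u(k) < 0.
ℓ : ∀ {n} → Vec ℤ n → ℕ
ℓ []       = 0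
ℓ (x ∷ xs) = χ⁺ (- x) + inversionsWith x xs + ℓ xs

χ⁺≤1 : ∀ z → χ⁺ z ≤ 1
χ⁺≤1 (+ zero)  = z≤n
χ⁺≤1 (+ suc _) = s≤s z≤n
χ⁺≤1 -[1+ _ ]  = z≤n

χ⁺-pos : ∀ {z} → 0ℤ ℤ.< z → χ⁺ z ≡ 1
χ⁺-pos {+ suc _} _ = refl
χ⁺-pos {+ zero}  (ℤ.+<+ ())

χ⁺-neg : ∀ {z} → 0ℤ ℤ.< z → χ⁺ (- z) ≡ 0
χ⁺-neg {+ suc _} _ = refl
χ⁺-neg {+ zero}  (ℤ.+<+ ())

χ⁺-neg-+ : ∀ k → χ⁺ (- + k) ≡ 0
χ⁺-neg-+ zero    = refl
χ⁺-neg-+ (suc k) = refl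

j<i⇒0<i-j : ∀ {i j} → j ℤ.< i → 0ℤ ℤ.< i ℤ.- j
j<i⇒0<i-j {i} {j} j<i = subst (ℤ._< i ℤ.- j) (ℤₚ.+-inverseʳ j) (ℤₚ.+-monoˡ-< (- j) j<i)

neg-[i-j] : ∀ i j → - (i ℤ.- j) ≡ j ℤ.- i
neg-[i-j] i j = begin
  - (i ℤ.- j)      ≡⟨ ℤₚ.neg-distrib-+ i (- j) ⟩
  - i ℤ.+ - - j    ≡⟨ cong (λ z → - i ℤ.+ z) (ℤₚ.neg-involutive j) ⟩
  - i ℤ.+ j        ≡⟨ ℤₚ.+-comm (- i) j ⟩
  j ℤ.- i          ∎
  where open ≡-Reasoning

χ⁺[i-j]≡0 : ∀ {i j} → i ℤ.< j → χ⁺ (i ℤ.- j) ≡ 0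
χ⁺[i-j]≡0 {i} {j} i<j = trans (cong χ⁺ (sym (neg-[i-j] j i))) (χ⁺-neg (j<i⇒0<i-j i<j))

inversions₂-neg : ∀ x y → inversions₂ (- x) y ≡ inversions₂ x y
inversions₂-neg x y = begin
  χ⁺ (- x ℤ.- y) + χ⁺ (- (- x ℤ.+ y))   ≡⟨ cong₂ _+_ (cong χ⁺ (sym (ℤₚ.neg-distrib-+ x y)))
                                                    (cong χ⁺ (ℤₚ.neg-distrib-+ (- x) y)) ⟩
  χ⁺ (- (x ℤ.+ y)) + χ⁺ (- - x ℤ.- y)   ≡⟨ cong (λ z → χ⁺ (- (x ℤ.+ y)) + χ⁺ (z ℤ.- y))
                                               (ℤₚ.neg-involutive x) ⟩
  χ⁺ (- (x ℤ.+ y)) + χ⁺ (x ℤ.- y)       ≡⟨ +-comm (χ⁺ (- (x ℤ.+ y))) _ ⟩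
  χ⁺ (x ℤ.- y) + χ⁺ (- (x ℤ.+ y))       ∎
  where open ≡-Reasoning

inversionsWith-neg : ∀ {n} x (ys : Vec ℤ n) → inversionsWith (- x) ys ≡ inversionsWith x ys
inversionsWith-neg x []       = refl
inversionsWith-neg x (y ∷ ys) = cong₂ _+_ (inversions₂-neg x y) (inversionsWith-neg x ys)

inversionsWith-swapAt : ∀ {n} x p (ys : Vec ℤ n) → inversionsWith x (swapAt p ys) ≡ inversionsWith x ys
inversionsWith-swapAt x zero    []          = refl
inversionsWith-swapAt x zero    (a ∷ [])    = refl
inversionsWith-swapAt x zero    (a ∷ b ∷ r) = x∙yz≈y∙xz (inversions₂ x b) (inversions₂ x a) (inversionsWith x r)
inversionsWith-swapAt x (suc p) []          = refl
inversionsWith-swapAt x (suc p) (a ∷ ys)    = cong (λ k → inversions₂ x a + k) (inversionsWith-swapAt x p ys)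

ℓ-negHead≤ : ∀ {n} (v : Vec ℤ n) → ℓ (negHead v) ≤ suc (ℓ v)
ℓ-negHead≤ []       = z≤n
ℓ-negHead≤ (x ∷ xs) rewrite ℤₚ.neg-involutive x | inversionsWith-neg x xs =
  +-monoˡ-≤ (ℓ xs) (+-monoˡ-≤ (inversionsWith x xs) (≤-trans (χ⁺≤1 x) (s≤s z≤n)))

ℓ-negHead< : ∀ {n} (v : Vec ℤ n) → at v 0 ℤ.< 0ℤ → suc (ℓ (negHead v)) ≤ ℓ v
ℓ-negHead< []              (ℤ.+<+ ())
ℓ-negHead< (+ _ ∷ xs)      (ℤ.+<+ ())
ℓ-negHead< (-[1+ k ] ∷ xs) _ rewrite inversionsWith-neg -[1+ k ] xs = ≤-refl

-- Only the pair (x, y) itself changes its contribution when x and y are exchanged.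
ℓ-swap-head : ∀ {n} x y (r : Vec ℤ n) →
  ℓ (y ∷ x ∷ r) + χ⁺ (x ℤ.- y) ≡ ℓ (x ∷ y ∷ r) + χ⁺ (y ℤ.- x)
ℓ-swap-head x y r rewrite ℤₚ.+-comm y x =
  rearrange (χ⁺ (- x)) (χ⁺ (- y)) (χ⁺ (x ℤ.- y)) (χ⁺ (y ℤ.- x)) (χ⁺ (- (x ℤ.+ y)))
            (inversionsWith x r) (inversionsWith y r) (ℓ r)
  where
  rearrange : ∀ a b d₁ d₂ s c₁ c₂ l →
    b + ((d₂ + s) + c₂) + (a + c₁ + l) + d₁ ≡ a + ((d₁ + s) + c₁) + (b + c₂ + l) + d₂
  rearrange = solve-∀

ℓ-swapAt≤ : ∀ {n} p (v : Vec ℤ n) → ℓ (swapAt p v) ≤ suc (ℓ v)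
ℓ-swapAt≤ zero    []          = z≤n
ℓ-swapAt≤ zero    (x ∷ [])    = n≤1+n _
ℓ-swapAt≤ zero    (x ∷ y ∷ r) = begin
  ℓ (y ∷ x ∷ r)                        ≤⟨ m≤m+n _ (χ⁺ (x ℤ.- y)) ⟩
  ℓ (y ∷ x ∷ r) + χ⁺ (x ℤ.- y)         ≡⟨ ℓ-swap-head x y r ⟩
  ℓ (x ∷ y ∷ r) + χ⁺ (y ℤ.- x)         ≤⟨ +-monoʳ-≤ (ℓ (x ∷ y ∷ r)) (χ⁺≤1 (y ℤ.- x)) ⟩
  ℓ (x ∷ y ∷ r) + 1                    ≡⟨ +-comm _ 1 ⟩
  suc (ℓ (x ∷ y ∷ r))                  ∎
  where open ≤-Reasoning
ℓ-swapAt≤ (suc p) []          = z≤n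
ℓ-swapAt≤ (suc p) (x ∷ xs) rewrite inversionsWith-swapAt x p xs =
  ≤-trans (+-monoʳ-≤ (χ⁺ (- x) + inversionsWith x xs) (ℓ-swapAt≤ p xs)) (≤-reflexive (+-suc _ (ℓ xs)))

ℓ-swapAt< : ∀ {n} p (v : Vec ℤ n) → suc p < n → at v (suc p) ℤ.< at v p → suc (ℓ (swapAt p v)) ≤ ℓ v
ℓ-swapAt< zero    (x ∷ [])    (s≤s ()) _
ℓ-swapAt< zero    (x ∷ y ∷ r) _ y<x = ≤-reflexive (begin
  suc (ℓ (y ∷ x ∷ r))              ≡⟨ +-comm 1 _ ⟩
  ℓ (y ∷ x ∷ r) + 1                ≡⟨ cong (λ k → ℓ (y ∷ x ∷ r) + k) (χ⁺-pos (j<i⇒0<i-j y<x)) ⟨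
  ℓ (y ∷ x ∷ r) + χ⁺ (x ℤ.- y)     ≡⟨ ℓ-swap-head x y r ⟩
  ℓ (x ∷ y ∷ r) + χ⁺ (y ℤ.- x)     ≡⟨ cong (λ k → ℓ (x ∷ y ∷ r) + k) (χ⁺[i-j]≡0 y<x) ⟩
  ℓ (x ∷ y ∷ r) + 0                ≡⟨ +-identityʳ _ ⟩
  ℓ (x ∷ y ∷ r)                    ∎)
  where open ≡-Reasoning
ℓ-swapAt< (suc p) (x ∷ xs) (s≤s p<n) lt rewrite inversionsWith-swapAt x p xs =
  ≤-trans (≤-reflexive (sym (+-suc (χ⁺ (- x) + inversionsWith x xs) _))) (+-monoʳ-≤ _ (ℓ-swapAt< p xs p<n lt))

ℓ-mulGen≤ : ∀ {n} (v : Vec ℤ n) m → ℓ (mulGen v m) ≤ suc (ℓ v)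
ℓ-mulGen≤ v m rewrite mulGen≡mulGenℕ v m with toℕ m
... | zero  = ℓ-negHead≤ v
... | suc p = ℓ-swapAt≤ p v

ℓ-foldl≤ : ∀ {n} (v : Vec ℤ n) w → ℓ (foldl mulGen v w) ≤ ℓ v + length w
ℓ-foldl≤ v []       = ≤-reflexive (sym (+-identityʳ _))
ℓ-foldl≤ v (m ∷ w)  = begin
  ℓ (foldl mulGen (mulGen v m) w)   ≤⟨ ℓ-foldl≤ (mulGen v m) w ⟩
  ℓ (mulGen v m) + length w         ≤⟨ +-monoˡ-≤ (length w) (ℓ-mulGen≤ v m) ⟩
  suc (ℓ v) + length w              ≡⟨ +-suc (ℓ v) (length w) ⟨
  ℓ v + length (m ∷ w)              ∎
  where open ≤-Reasoning

inversionsWith-<≡0 : ∀ {n} c (f : Fin n → ℕ) → (∀ j → c < f j) → inversionsWith (+ c) (tabulate (+_ ∘ f)) ≡ 0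
inversionsWith-<≡0 {zero}  c f c<f = refl
inversionsWith-<≡0 {suc n} c f c<f =
  cong₂ _+_ (cong₂ _+_ (χ⁺[i-j]≡0 (ℤ.+<+ (c<f Fin.zero))) (χ⁺-neg-+ (c + f Fin.zero)))
            (inversionsWith-<≡0 c (f ∘ Fin.suc) (c<f ∘ Fin.suc))

ℓ-increasing≡0 : ∀ {n} (f : Fin n → ℕ) → (∀ {i j} → toℕ i < toℕ j → f i < f j) →
  ℓ (tabulate (+_ ∘ f)) ≡ 0
ℓ-increasing≡0 {zero}  f f-< = refl
ℓ-increasing≡0 {suc n} f f-< =
  cong₂ _+_ (cong₂ _+_ (χ⁺-neg-+ (f Fin.zero))
                       (inversionsWith-<≡0 (f Fin.zero) (f ∘ Fin.suc) (λ _ → f-< (s≤s z≤n))))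
            (ℓ-increasing≡0 (f ∘ Fin.suc) (f-< ∘ s≤s))

ℓ-idW : ∀ n → ℓ (idW n) ≡ 0
ℓ-idW n = ℓ-increasing≡0 {n} (suc ∘ toℕ) s≤s

ℓ-prod≤length : ∀ {n} (w : List (Fin n)) → ℓ (prod w) ≤ length w
ℓ-prod≤length {n} w = subst (λ l → ℓ (prod w) ≤ l + length w) (ℓ-idW n) (ℓ-foldl≤ (idW n) w)

-- Descents

Descent : ∀ {n} → Vec ℤ n → Fin n → Set
Descent v m = suc (ℓ (mulGen v m)) ≤ ℓ v

descent-suc : ∀ {n} (v : Vec ℤ n) p (p<n : suc p < n) → at v (suc p) ℤ.< at v p → Descent v (fromℕ< p<n)
descent-suc v p p<n lt = subst (λ w → suc (ℓ w) ≤ ℓ v) (sym mulGen≡swapAt) (ℓ-swapAt< p v p<n lt)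
  where
  mulGen≡swapAt : mulGen v (fromℕ< p<n) ≡ swapAt p v
  mulGen≡swapAt = trans (mulGen≡mulGenℕ v (fromℕ< p<n)) (cong (mulGenℕ v) (Finₚ.toℕ-fromℕ< p<n))

increasing⇒≡suc : ∀ {n} (f : ℕ → ℕ) → (∀ j → suc j < n → f j < f (suc j)) →
  (∀ j → j < n → 1 ≤ f j × f j ≤ n) → ∀ j → j < n → f j ≡ suc j
increasing⇒≡suc {n} f f-< bounds j j<n with m≤n⇒∃[o]m+o≡n j<n
... | d , j+d≡n = ≤-antisym
  (+-cancelʳ-≤ d (f j) (suc j) (subst (f j + d ≤_) (sym j+d≡n) (upper d j (≤-reflexive j+d≡n))))
  (lower j j<n)
  where
  lower : ∀ j → j < n → suc j ≤ f j
  lower zero    j<n = proj₁ (bounds 0 j<n)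
  lower (suc j) j<n = ≤-trans (s≤s (lower j (<⇒≤ j<n))) (f-< j j<n)
  upper : ∀ d j → suc j + d ≤ n → f j + d ≤ n
  upper zero    j j<n = subst (_≤ n) (sym (+-identityʳ (f j))) (proj₂ (bounds j (≤-trans (m≤m+n (suc j) 0) j<n)))
  upper (suc d) j j+d<n = begin
    f j + suc d        ≡⟨ +-suc (f j) d ⟩
    suc (f j) + d      ≤⟨ +-monoˡ-≤ d (f-< j (≤-trans (m≤m+n (suc (suc j)) d) sj+d<n)) ⟩
    f (suc j) + d      ≤⟨ upper d (suc j) sj+d<n ⟩
    n                  ∎
    where
    open ≤-Reasoning
    sj+d<n : suc (suc j) + d ≤ n
    sj+d<n = subst (_≤ n) (cong suc (+-suc j d)) j+d<n

noDescent⇒idW : ∀ {n} (v : Vec ℤ n) → IsSignedPermℕ v → (∀ m → ¬ Descent v m) → v ≡ idW n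
noDescent⇒idW {zero}  []  _  _         = refl
noDescent⇒idW {suc n} v   sp noDescent = at-ext v (idW (suc n)) λ j j<n → begin
  at v j              ≡⟨ +∣at∣ j j<n ⟨
  + ∣ at v j ∣        ≡⟨ cong +_ (increasing⇒≡suc (∣_∣ ∘ at v) ∣at∣-< (∣at∣-bounds sp) j j<n) ⟩
  + suc j             ≡⟨ at-idW (suc n) j j<n ⟨
  at (idW (suc n)) j  ∎
  where
  open ≡-Reasoning
  ascending : ∀ p → suc p < suc n → at v p ℤ.≤ at v (suc p)
  ascending p p<n = ℤₚ.≮⇒≥ (noDescent (fromℕ< p<n) ∘ descent-suc v p p<n)
  nonnegative : ∀ j → j < suc n → 0ℤ ℤ.≤ at v j
  nonnegative zero    _   = ℤₚ.≮⇒≥ (noDescent Fin.zero ∘ ℓ-negHead< v)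
  nonnegative (suc p) p<n = ℤₚ.≤-trans (nonnegative p (<⇒≤ p<n)) (ascending p p<n)
  +∣at∣ : ∀ j → j < suc n → + ∣ at v j ∣ ≡ at v j
  +∣at∣ j j<n = ℤₚ.0≤i⇒+∣i∣≡i (nonnegative j j<n)
  ∣at∣-< : ∀ p → suc p < suc n → ∣ at v p ∣ < ∣ at v (suc p) ∣
  ∣at∣-< p p<n = ≤∧≢⇒<
    (ℤₚ.drop‿+≤+ (subst₂ ℤ._≤_ (sym (+∣at∣ p (<⇒≤ p<n))) (sym (+∣at∣ (suc p) p<n)) (ascending p p<n)))
    (λ e → 1+n≢n (sym (∣at∣-injective sp (<⇒≤ p<n) p<n e)))

shortWord : ∀ fuel {n} (v : Vec ℤ n) → IsSignedPermℕ v → ℓ v ≤ fuel →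
  Σ (List (Fin n)) λ w → prod w ≡ v × length w ≤ ℓ v
shortWord zero       v sp ℓ≤0 =
  [] , sym (noDescent⇒idW v sp λ _ d → 1+n≰n (≤-trans d (≤-trans ℓ≤0 z≤n))) , z≤n
shortWord (suc fuel) v sp ℓ≤ with Finₚ.any? (λ m → suc (ℓ (mulGen v m)) ≤? ℓ v)
... | no  noDescent    = [] , sym (noDescent⇒idW v sp λ m d → noDescent (m , d)) , z≤n
... | yes (m , descent) with shortWord fuel (mulGen v m) (IsSignedPermℕ-mulGen v m sp) (≤-pred (≤-trans descent ℓ≤))
...   | w , prod-w , length-w = w ++ [ m ] , prod-w∷m , length-w∷m
  where
  open ≤-Reasoning
  prod-w∷m : prod (w ++ [ m ]) ≡ v
  prod-w∷m = trans (prod-++-∷ w m []) (trans (cong (λ x → mulGen x m) prod-w) (mulGen-involutive v m))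
  length-w∷m : length (w ++ [ m ]) ≤ ℓ v
  length-w∷m = begin
    length (w ++ [ m ])    ≡⟨ Listₚ.length-++ w ⟩
    length w + 1           ≡⟨ +-comm (length w) 1 ⟩
    suc (length w)         ≤⟨ s≤s length-w ⟩
    suc (ℓ (mulGen v m))   ≤⟨ descent ⟩
    ℓ v                    ∎

reducedWord : ∀ {n} {u : Vec ℤ n} → IsSignedPermℕ u → Σ (List (Fin n)) λ w → IsReduced w u
reducedWord {u = u} sp with shortWord (ℓ u) u sp ≤-refl
... | w , prod-w , length-w = w , prod-w , λ w′ prod-w′ →
  ≤-trans length-w (subst (λ x → ℓ x ≤ length w′) prod-w′ (ℓ-prod≤length w′))

reduced⇒length≤ℓ : ∀ {n} {u : Vec ℤ n} {w} → IsSignedPermℕ u → IsReduced w u → length w ≤ ℓ u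
reduced⇒length≤ℓ {u = u} sp (_ , minimal) with shortWord (ℓ u) u sp ≤-refl
... | c , prod-c , length-c = ≤-trans (minimal c prod-c) length-c

-- The condition C(u)

∣val-negHead∣ : ∀ {n} (v : Vec ℤ n) j → ∣ val (negHead v) j ∣ ≡ ∣ val v j ∣
∣val-negHead∣ v zero    = refl
∣val-negHead∣ v (suc j) = ∣at-negHead∣ v j

val-swapAt : ∀ {n} p (v : Vec ℤ n) j → suc p < n → val (swapAt p v) j ≡ val v (swapIndex (suc p) j)
val-swapAt p v zero    _   = refl
val-swapAt p v (suc j) p<n = at-swapAt p v j p<n

-- For k ≠ i, τ_k permutes the positions within {0, …, i} and within {i+1, …, n}; the sign change
-- made by τ₀ at position 1 is harmless as then i ≥ 1, and u(1) enters only through |u(1)|.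
Cond-mulGenℕ : ∀ {n} k (v : Vec ℤ n) (i : Fin n) → k < n → k ≢ toℕ i → Cond i v → Cond i (mulGenℕ v k)
Cond-mulGenℕ zero    v i _ _   c j zero          _   ()
Cond-mulGenℕ zero    v i _ 0≢i c j (suc zero)    _   (s≤s i≤0) _ = ⊥-elim (0≢i (sym (n≤0⇒n≡0 i≤0)))
Cond-mulGenℕ zero    v i _ _   c j (suc (suc k)) j≤i i<k k≤n
  rewrite ∣val-negHead∣ v j | at-negHead-suc v k = c j (suc (suc k)) j≤i i<k k≤n
Cond-mulGenℕ (suc p) v i p<n p≢i c j k j≤i i<k k≤n
  rewrite val-swapAt p v j p<n | val-swapAt p v k p<n =
  c (swapIndex (suc p) j) (swapIndex (suc p) k)
    (swapIndex-≤ (suc p) p≢i j≤i) (swapIndex-> (suc p) p≢i i<k) (swapIndex-≤ (suc p) (<⇒≢ p<n) k≤n)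

Cond-mulGen : ∀ {n} (v : Vec ℤ n) (i m : Fin n) → m ≢ i → Cond i v → Cond i (mulGen v m)
Cond-mulGen v i m m≢i c = subst (Cond i) (sym (mulGen≡mulGenℕ v m))
  (Cond-mulGenℕ (toℕ m) v i (Finₚ.toℕ<n m) (m≢i ∘ Finₚ.toℕ-injective) c)

Cond-foldl : ∀ {n} (v : Vec ℤ n) i w → i ∉ w → Cond i v → Cond i (foldl mulGen v w)
Cond-foldl v i []      _   c = c
Cond-foldl v i (m ∷ w) i∉w c =
  Cond-foldl (mulGen v m) i w (i∉w ∘ there) (Cond-mulGen v i m (i∉w ∘ here ∘ sym) c)

Cond-foldl⁻ : ∀ {n} (v : Vec ℤ n) i w → i ∉ w → Cond i (foldl mulGen v w) → Cond i v
Cond-foldl⁻ v i []      _   c = c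
Cond-foldl⁻ v i (m ∷ w) i∉w c = subst (Cond i) (mulGen-involutive v m)
  (Cond-mulGen (mulGen v m) i m (i∉w ∘ here ∘ sym) (Cond-foldl⁻ (mulGen v m) i w (i∉w ∘ there) c))

val-idW : ∀ n j → j ≤ n → val (idW n) j ≡ + j
val-idW n zero    _   = refl
val-idW n (suc j) j<n = at-idW n j j<n

Cond-idW : ∀ n (i : Fin n) → Cond i (idW n)
Cond-idW n i j k j≤i i<k k≤n rewrite val-idW n j (≤-trans j≤i (<⇒≤ (Finₚ.toℕ<n i))) | val-idW n k k≤n =
  ℤ.+<+ (≤-<-trans j≤i i<k)

∉word⇒Cond : ∀ {n} {u : Vec ℤ n} {w} i → prod w ≡ u → i ∉ w → Cond i u
∉word⇒Cond {n} {w = w} i prod-w i∉w = subst (Cond i) prod-w (Cond-foldl (idW n) i w i∉w (Cond-idW n i))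

0<-i⇒i<0 : ∀ {i} → 0ℤ ℤ.< - i → i ℤ.< 0ℤ
0<-i⇒i<0 { -[1+ _ ]} _          = ℤ.-<+
0<-i⇒i<0 {+ zero}    (ℤ.+<+ ())
0<-i⇒i<0 {+ suc _}   ()

i≤+∣i∣ : ∀ i → i ℤ.≤ + ∣ i ∣
i≤+∣i∣ (+ _)     = ℤ.+≤+ ≤-refl
i≤+∣i∣ -[1+ _ ]  = ℤ.-≤+

-- For w = y τ_i, Cond i w gives |w(i)| < w(i+1) (that is, w(1) > 0 when i = 0), so y = w τ_i has one
-- inversion more than w.
Cond⇒descent : ∀ {n} (y : Vec ℤ n) (i : Fin n) → Cond i (mulGen y i) → Descent y i
Cond⇒descent y i c = subst (λ w → suc (ℓ w) ≤ ℓ y) (sym (mulGen≡mulGenℕ y i))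
  (ascent⇒descent (toℕ i) (Finₚ.toℕ<n i)
    (subst (Cond i) (mulGen≡mulGenℕ y i) c (toℕ i) (suc (toℕ i)) ≤-refl ≤-refl (Finₚ.toℕ<n i)))
  where
  ascent⇒descent : ∀ k → k < _ → + ∣ val (mulGenℕ y k) k ∣ ℤ.< val (mulGenℕ y k) (suc k) →
    suc (ℓ (mulGenℕ y k)) ≤ ℓ y
  ascent⇒descent zero    _   0<-y₀ = ℓ-negHead< y (0<-i⇒i<0 (subst (0ℤ ℤ.<_) (at-negHead-zero y) 0<-y₀))
  ascent⇒descent (suc p) p<n lt   = ℓ-swapAt< p y p<n (ℤₚ.≤-<-trans (i≤+∣i∣ _)
    (subst₂ (λ a b → + ∣ a ∣ ℤ.< b)
            (trans (at-swapAt p y p p<n) (cong (at y) (swapIndex-self p)))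
            (trans (at-swapAt p y (suc p) p<n) (cong (at y) (swapIndex-suc p))) lt))

lastOccurrence : ∀ {n} {i : Fin n} {w} → i ∈ w → ∃₂ λ a b → w ≡ a ++ i ∷ b × i ∉ b
lastOccurrence {i = i} {x ∷ w} i∈x∷w with any? (i Fin.≟_) w
... | yes i∈w with lastOccurrence i∈w
...   | a , b , w≡a++i∷b , i∉b = x ∷ a , b , cong (x ∷_) w≡a++i∷b , i∉b
lastOccurrence (here refl)  | no i∉w = [] , _ , refl , i∉w
lastOccurrence (there i∈w)  | no i∉w = ⊥-elim (i∉w i∈w)

-- Past the last τ_i the condition still holds, so that τ_i was a descent and the word can be shortened.
Cond⇒ℓ<length : ∀ {n} {u : Vec ℤ n} a i b → prod (a ++ i ∷ b) ≡ u → i ∉ b → Cond i u →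
  ℓ u < length (a ++ i ∷ b)
Cond⇒ℓ<length {u = u} a i b prod-w i∉b c = begin-strict
  ℓ u                     ≡⟨ cong ℓ u≡z·b ⟩
  ℓ (foldl mulGen z b)    ≤⟨ ℓ-foldl≤ z b ⟩
  ℓ z + length b          <⟨ +-monoˡ-< (length b) (≤-trans (Cond⇒descent (prod a) i Cond-z) (ℓ-prod≤length a)) ⟩
  length a + length b     <⟨ +-monoʳ-< (length a) (n<1+n (length b)) ⟩
  length a + suc (length b) ≡⟨ Listₚ.length-++ a ⟨
  length (a ++ i ∷ b)     ∎
  where
  open ≤-Reasoning
  z : Vec ℤ _
  z = mulGen (prod a) i
  u≡z·b : u ≡ foldl mulGen z b
  u≡z·b = trans (sym prod-w) (prod-++-∷ a i b)
  Cond-z : Cond i z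
  Cond-z = Cond-foldl⁻ z i b i∉b (subst (Cond i) u≡z·b c)

Cond⇒∉reduced : ∀ {n} {u : Vec ℤ n} {w} i → IsSignedPermℕ u → Cond i u → IsReduced w u → i ∉ w
Cond⇒∉reduced i sp c reduced i∈w with lastOccurrence i∈w
... | a , b , refl , i∉b =
  <⇒≱ (Cond⇒ℓ<length a i b (proj₁ reduced) i∉b c) (reduced⇒length≤ℓ {w = a ++ i ∷ b} sp reduced)

mainTheorem16 : (n : ℕ) (u : Vec ℤ n) → IsSignedPerm u →
    (i : Fin n) → InC i u ⇔ Cond i u
mainTheorem16 n u sp i = mk⇔ InC⇒Cond Cond⇒InC
  where
  sp′ : IsSignedPermℕ u
  sp′ = IsSignedPerm⇒IsSignedPermℕ u sp
  InC⇒Cond : InC i u → Cond i u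
  InC⇒Cond τᵢ∈C with reducedWord sp′
  ... | w , reduced = ∉word⇒Cond i (proj₁ reduced) (λ i∈w → τᵢ∈C (w , reduced , i∈w))
  Cond⇒InC : Cond i u → InC i u
  Cond⇒InC c (w , reduced , i∈w) = Cond⇒∉reduced i sp′ c reduced i∈w
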